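{- Let $t\equiv 3\pmod 4$ and let $\mathcal{S}$ be a $\mathrm{BP}(t+1,4)$ on the point set $\mathbb{Z}_t\cup\{\Omega_1\}$. For each parallel class $\mathcal{R}$ of $\mathcal{S}$ define a set $\mathcal{R}'$ of $4$-subsets of $\mathbb{Z}_t\times\mathbb{Z}_4$ as follows: for each block $B\in\mathcal{R}$, if $\Omega_1\notin B=\{x_0,x_1,x_2,x_3\}$ put the four quadruples $\{(x_0,i),(x_1,i),(x_2,i),(x_3,i)\}$, $i\in\mathbb{Z}_4$, into $\mathcal{R}'$; if $B=\{x_0,x_1,x_2,\Omega_1\}$ with $x_0<x_1<x_2$ in $\mathbb{Z}_t$, put the three quadruples $\{(x_0,i),(x_1,i),(x_2,i),(x_i,3)\}$, $i\in\{0,1,2\}$, into $\mathcal{R}'$. Then (1) each $\mathcal{R}'$ is a parallel class on $\mathbb{Z}_t\times\mathbb{Z}_4$; (2) each $4$-subset of $\mathbb{Z}_t\times\mathbb{Z}_4$ whose four points all have the same second coordinate is contained in exactly one such parallel class; (3) the number of such parallel classes is $\binom{t}{3}$, and each contains $t-3$ quadruples whose four points have the same second coordinate and three quadruples having three points with one common second coordinate and the fourth point with a different second coordinate.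
   Context: A $\mathrm{BP}(n,4)$ on an $n$-set $V$ is a partition of all $4$-subsets of $V$ into parallel classes, a parallel class being a set of pairwise disjoint $4$-subsets whose union is $V$. Elements of $\mathbb{Z}_t$ are ordered as integers $0<1<\dots<t-1$. -}

module Defs where

open import Data.Nat using (ℕ; zero; suc; _*_)
open import Data.Bool using (Bool; true; false; _∧_)
open import Data.Fin using (Fin; zero; suc; combine; remQuot; _≟_; #_)
open import Data.Fin.Properties using (any?; all?)
open import Data.Fin.Subset using (Subset; _∈_; _∩_; _∪_; ⁅_⁆; ⋃; ∣_∣; ⊤; Empty)
open import Data.Fin.Subset.Properties using (_∈?_)
open import Data.List using (List; []; _∷_; filter; allFin; concatMap; length; lookup)
open import Data.List.Relation.Unary.All using (All)
open import Data.List.Relation.Unary.AllPairs using (AllPairs)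
import Data.List.Membership.Propositional as LM
open import Data.Vec using (Vec; tabulate; init; last)
import Data.Vec as V
open import Data.Product using (Σ; ∃; _×_; _,_; proj₁; proj₂)
open import Relation.Nullary using (Dec; ¬_; _×-dec_; _→-dec_; ⌊_⌋; ¬?)

open import Relation.Binary.PropositionalEquality using (_≡_; _≢_)
open import Data.Nat.Properties using () renaming (_≟_ to _≟ℕ_)

IsKSubset : ∀ {n} → ℕ → Subset n → Set
IsKSubset k B = ∣ B ∣ ≡ k

ParallelClass : ∀ n → List (Subset n) → Set
ParallelClass n R =
  All (IsKSubset 4) R × AllPairs (λ A B → Empty (A ∩ B)) R × ⋃ R ≡ ⊤

ExactlyOneClass : ∀ {n} → List (List (Subset n)) → Subset n → Set
ExactlyOneClass S B =
  Σ (Fin (length S)) λ i →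
    (B LM.∈ lookup S i) × (∀ j → B LM.∈ lookup S j → j ≡ i)

BP : ∀ n → List (List (Subset n)) → Set
BP n S = All (ParallelClass n) S × (∀ B → IsKSubset 4 B → ExactlyOneClass S B)

-- The point set Z_t ∪ {Ω₁} is Fin (suc t): x ∈ Z_t is Data.Fin.inject₁ x
-- (so the order on Z_t is the integer order), Ω₁ is the last point
-- Data.Fin.fromℕ t.  For a subset B of Fin (suc t):
--   last B  = whether Ω₁ ∈ B,   init B = B ∩ Z_t  as a subset of Fin t.
--
-- The point set Z_t × Z_4 is Fin (t * 4), the point (x , i) being
-- combine x i (inverse: remQuot 4).

layer : ∀ {t} → Fin (t * 4) → Fin 4
layer {t} k = proj₂ (remQuot {t} 4 k)

atLayer : ∀ {t} → Subset t → Fin 4 → Subset (t * 4)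
atLayer {t} A i = tabulate λ k → V.lookup A (proj₁ (remQuot {t} 4 k)) ∧ ⌊ layer {t} k ≟ i ⌋

elems : ∀ {t} → Subset t → List (Fin t)
elems {t} A = filter (_∈? A) (allFin t)

blocks' : ∀ {t} → Subset (suc t) → List (Subset (t * 4))
blocks' {t} B with last B
... | false = atLayer (init B) (# 0) ∷ atLayer (init B) (# 1)
            ∷ atLayer (init B) (# 2) ∷ atLayer (init B) (# 3) ∷ []
... | true with elems (init B)
...   | x₀ ∷ x₁ ∷ x₂ ∷ [] =
          (atLayer (init B) (# 0) ∪ ⁅ combine x₀ (# 3) ⁆)
        ∷ (atLayer (init B) (# 1) ∪ ⁅ combine x₁ (# 3) ⁆)
        ∷ (atLayer (init B) (# 2) ∪ ⁅ combine x₂ (# 3) ⁆) ∷ []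
...   | _ = []   -- impossible when B is a 4-subset containing Ω₁

derived : ∀ {t} → List (Subset (suc t)) → List (Subset (t * 4))
derived {t} R = concatMap (blocks' {t}) R

SameLayer : ∀ {t} → Subset (t * 4) → Set
SameLayer {t} B = ∃ λ i → ∀ k → k ∈ B → layer {t} k ≡ i

sameLayer? : ∀ {t} (B : Subset (t * 4)) → Dec (SameLayer {t} B)
sameLayer? {t} B = any? λ i → all? λ k → (k ∈? B) →-dec (layer {t} k ≟ i)

layerCount : ∀ {t} → Subset (t * 4) → Fin 4 → ℕ
layerCount {t} B i = ∣ B ∩ tabulate (λ k → ⌊ layer {t} k ≟ i ⌋) ∣

ThreeOne : ∀ {t} → Subset (t * 4) → Set
ThreeOne {t} B = ∃ λ i → ∃ λ j →
  i ≢ j × layerCount {t} B i ≡ 3 × layerCount {t} B j ≡ 1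

threeOne? : ∀ {t} (B : Subset (t * 4)) → Dec (ThreeOne {t} B)
threeOne? {t} B = any? λ i → any? λ j →
  ¬? (i ≟ j) ×-dec (layerCount {t} B i ≟ℕ 3) ×-dec (layerCount {t} B j ≟ℕ 1)

module Submission where

-- A quadruple Q of R′ remembers the block B it comes from: B ∖ {Ω₁} is the shadow of Q on Z_t, and
-- Ω₁ ∈ B exactly when the points of Q do not share a layer.  Hence quadruples of different blocks
-- differ, a flat 4-set A × {i} lies in R′ exactly when A ∈ R, and different classes have different R′.
-- Quadruples lie over their blocks, so those of disjoint blocks are disjoint and R′ is a parallel
-- class.  A class R has (t + 1)/4 blocks, exactly one of which contains Ω₁; it yields the three
-- non-flat quadruples and the other blocks the t − 3 flat ones.  Finally the classes are in bijection
-- with their blocks through Ω₁, that is, with the 3-subsets of Z_t.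

open import Defs
open import Algebra.Properties.CommutativeSemigroup using (x∙yz≈y∙xz)
open import Data.Bool using (Bool; true; false; _∧_; not)
open import Data.Bool.Properties using (∧-conicalˡ; ∧-conicalʳ)
open import Data.Empty using (⊥-elim)
open import Data.Fin using (Fin; zero; suc; inject₁; fromℕ; combine; quotient; _≟_; _↑ˡ_; _↑ʳ_; #_)
import Data.Fin.Properties as Fin
open import Data.Fin.Properties using (remQuot-combine; combine-remQuot; combine-injectiveˡ; any?)
open import Data.Fin.Subset using (Subset; _⊆_; _∩_; _∪_; ⁅_⁆; ⋃; ∣_∣; ⊤; ⊥; Empty)
open import Data.Fin.Subset.Properties
  using (_∈?_; drop-∷-Empty; x∈p∩q⁺; x∈p∩q⁻; x∈p∪q⁺; x∈p∪q⁻; ∉⊥; ∈⊤; ⊆⊤; ⊆-antisym; p∩q⊆p; p∩q⊆q;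
         Empty-unique; ∩-distribʳ-∪; x∈⁅x⁆; x∈⁅y⁆⇒x≡y; ∣⊥∣≡0; ∣⊤∣≡n; ∣⁅x⁆∣≡1)
open import Data.List using (List; []; _∷_; _++_; length; filter; allFin; map; concatMap)
import Data.List as List
open import Data.List.Membership.Propositional using (find; lose) renaming (_∈_ to _∈ₗ_)
open import Data.List.Membership.Propositional.Properties
  using (∈-filter⁺; ∈-filter⁻; ∈-allFin; ∈-concatMap⁺; ∈-concatMap⁻; ∈-lookup; ∈-∃++; ∈-++⁻; ∈-++⁺ˡ; ∈-++⁺ʳ;
         ∈-map⁺; ∈-map⁻)
open import Data.List.Properties
  using (filter-accept; filter-reject; filter-none; filter-all; filter-++; length-++; length-map)
open import Data.List.Relation.Binary.Disjoint.Propositional using () renaming (Disjoint to Disjointₗ)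
open import Data.List.Relation.Unary.All using (All; []; _∷_)
import Data.List.Relation.Unary.All as All
import Data.List.Relation.Unary.All.Properties as AllP
open import Data.List.Relation.Unary.AllPairs using (AllPairs; []; _∷_)
import Data.List.Relation.Unary.AllPairs as AllPairs
import Data.List.Relation.Unary.AllPairs.Properties as AllPairsP
open import Data.List.Relation.Unary.Any using (Any; here; there)
import Data.List.Relation.Unary.Any as Any
import Data.List.Relation.Unary.Any.Properties as AnyP
open import Data.List.Relation.Unary.Any.Properties using (lookup-index)
open import Data.List.Relation.Unary.Unique.Propositional using (Unique)
import Data.List.Relation.Unary.Unique.Propositional.Properties as Unique
open import Data.Nat using (ℕ; zero; suc; _+_; _*_; _∸_; _%_; _≤_; z≤n; s≤s)
open import Data.Nat.Combinatorics using (_C_; nCk+nC[k+1]≡[n+1]C[k+1])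
open import Data.Nat.Properties
  using (+-suc; *-suc; *-zeroʳ; +-identityʳ; +-assoc; suc-injective; 0≢1+n; m+n∸n≡m; ≤-antisym;
         +-commutativeSemigroup; module ≤-Reasoning)
open import Data.Product using (∃; _×_; _,_; proj₁; proj₂)
import Data.Product as Product
open import Data.Sum using (_⊎_; inj₁; inj₂)
open import Data.Vec using (Vec; []; _∷_; lookup; tabulate; init; last; _∷ʳ_; initLast)
import Data.Vec as Vec
open import Data.Vec.Properties
  using (∷-injectiveʳ; ∷ʳ-injectiveˡ; init-∷ʳ; last-∷ʳ; lookup∘tabulate; tabulate∘lookup; tabulate-cong;
         []=⇒lookup; lookup⇒[]=)
open import Function using (_∘_; id; case_of_)
open import Relation.Binary.PropositionalEquality
open import Relation.Nullary using (Dec; yes; no; does; ⌊_⌋; ¬_; contradiction)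
import Relation.Unary as U

private
  variable
    n k : ℕ

module _ where

  open import Data.Fin.Subset using (_∈_; _∉_)

  ⌊⌋-true⁻ : {P : Set} (P? : Dec P) → ⌊ P? ⌋ ≡ true → P
  ⌊⌋-true⁻ (yes p) _ = p

  ⌊⌋-true⁺ : {P : Set} (P? : Dec P) → P → ⌊ P? ⌋ ≡ true
  ⌊⌋-true⁺ (yes _) _ = refl
  ⌊⌋-true⁺ (no ¬p) p = ⊥-elim (¬p p)

  ⌊⌋-false⁺ : {P : Set} (P? : Dec P) → ¬ P → ⌊ P? ⌋ ≡ false
  ⌊⌋-false⁺ (yes p) ¬p = ⊥-elim (¬p p)
  ⌊⌋-false⁺ (no _)  _  = refl

  length-filter-++ : {A : Set} {P : A → Set} (P? : U.Decidable P) (xs ys : List A) →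
                     length (filter P? (xs ++ ys)) ≡ length (filter P? xs) + length (filter P? ys)
  length-filter-++ P? xs ys = trans (cong length (filter-++ P? xs ys)) (length-++ (filter P? xs))

  length≡1⇒unique : {A : Set} {xs : List A} → length xs ≡ 1 → Unique xs
  length≡1⇒unique {xs = _ ∷ []} _ = [] ∷ []

  length-concatMap-singletons : {A B : Set} {f : A → List B} {xs : List A} →
                                All (λ x → length (f x) ≡ 1) xs → length (concatMap f xs) ≡ length xs
  length-concatMap-singletons [] = refl
  length-concatMap-singletons {f = f} {x ∷ _} (∣fx∣≡1 ∷ ∣fxs∣≡1) =
    trans (length-++ (f x)) (cong₂ _+_ ∣fx∣≡1 (length-concatMap-singletons ∣fxs∣≡1))

  length≡3⇒ : {A : Set} (xs : List A) → length xs ≡ 3 → ∃ λ a → ∃ λ b → ∃ λ c → xs ≡ a ∷ b ∷ c ∷ []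
  length≡3⇒ (a ∷ b ∷ c ∷ []) refl = a , b , c , refl

  Unique-⊆⇒length≤ : {A : Set} {xs ys : List A} → Unique xs → (∀ {x} → x ∈ₗ xs → x ∈ₗ ys) →
                     length xs ≤ length ys
  Unique-⊆⇒length≤ {xs = []}     _                 _     = z≤n
  Unique-⊆⇒length≤ {xs = x ∷ xs} (x∉xs ∷ xs-unique) xs⊆ys with ∈-∃++ (xs⊆ys (here refl))
  ... | ys₁ , ys₂ , refl = begin
    suc (length xs)               ≤⟨ s≤s (Unique-⊆⇒length≤ xs-unique xs⊆ys₁ys₂) ⟩
    suc (length (ys₁ ++ ys₂))     ≡⟨ cong suc (length-++ ys₁) ⟩
    suc (length ys₁ + length ys₂) ≡⟨ +-suc (length ys₁) (length ys₂) ⟨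
    length ys₁ + suc (length ys₂) ≡⟨ length-++ ys₁ ⟨
    length (ys₁ ++ x ∷ ys₂)       ∎
    where
    open ≤-Reasoning
    xs⊆ys₁ys₂ : ∀ {y} → y ∈ₗ xs → y ∈ₗ ys₁ ++ ys₂
    xs⊆ys₁ys₂ y∈xs with ∈-++⁻ ys₁ (xs⊆ys (there y∈xs))
    ... | inj₁ y∈ys₁         = ∈-++⁺ˡ y∈ys₁
    ... | inj₂ (here refl)   = contradiction refl (All.lookup x∉xs y∈xs)
    ... | inj₂ (there y∈ys₂) = ∈-++⁺ʳ ys₁ y∈ys₂

  Disjoint : Subset n → Subset n → Set
  Disjoint p q = Empty (p ∩ q)

  ∈-tabulate⁺ : {f : Fin n → Bool} {x : Fin n} → f x ≡ true → x ∈ tabulate f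
  ∈-tabulate⁺ {f = f} {x} fx = lookup⇒[]= x _ (trans (lookup∘tabulate f x) fx)

  ∈-tabulate⁻ : {f : Fin n → Bool} {x : Fin n} → x ∈ tabulate f → f x ≡ true
  ∈-tabulate⁻ {f = f} {x} x∈ = trans (sym (lookup∘tabulate f x)) ([]=⇒lookup x∈)

  ∣p∪q∣≡∣p∣+∣q∣ : (p q : Subset n) → Disjoint p q → ∣ p ∪ q ∣ ≡ ∣ p ∣ + ∣ q ∣
  ∣p∪q∣≡∣p∣+∣q∣ []          []          _ = refl
  ∣p∪q∣≡∣p∣+∣q∣ (true ∷ p)  (true ∷ q)  d = ⊥-elim (d (zero , Vec.here))
  ∣p∪q∣≡∣p∣+∣q∣ (true ∷ p)  (false ∷ q) d = cong suc (∣p∪q∣≡∣p∣+∣q∣ p q (drop-∷-Empty d))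
  ∣p∪q∣≡∣p∣+∣q∣ (false ∷ p) (true ∷ q)  d =
    trans (cong suc (∣p∪q∣≡∣p∣+∣q∣ p q (drop-∷-Empty d))) (sym (+-suc ∣ p ∣ ∣ q ∣))
  ∣p∪q∣≡∣p∣+∣q∣ (false ∷ p) (false ∷ q) d = ∣p∪q∣≡∣p∣+∣q∣ p q (drop-∷-Empty d)

  x∈⋃⁺ : {x : Fin n} {ps : List (Subset n)} → Any (x ∈_) ps → x ∈ ⋃ ps
  x∈⋃⁺ {ps = p ∷ ps} (here x∈p)   = x∈p∪q⁺ (inj₁ x∈p)
  x∈⋃⁺ {ps = p ∷ ps} (there x∈ps) = x∈p∪q⁺ (inj₂ (x∈⋃⁺ x∈ps))

  x∈⋃⁻ : {x : Fin n} (ps : List (Subset n)) → x ∈ ⋃ ps → Any (x ∈_) ps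
  x∈⋃⁻ []       x∈ = ⊥-elim (∉⊥ x∈)
  x∈⋃⁻ (p ∷ ps) x∈ with x∈p∪q⁻ p (⋃ ps) x∈
  ... | inj₁ x∈p  = here x∈p
  ... | inj₂ x∈ps = there (x∈⋃⁻ ps x∈ps)

  ⋃≡⊤ : (ps : List (Subset n)) → (∀ x → x ∈ ⋃ ps) → ⋃ ps ≡ ⊤
  ⋃≡⊤ ps cover = ⊆-antisym ⊆⊤ (λ {x} _ → cover x)

  disjoint-⋃ : {p : Subset n} (ps : List (Subset n)) → All (Disjoint p) ps → Disjoint p (⋃ ps)
  disjoint-⋃ {p = p} [] [] (x , x∈) = ∉⊥ (proj₂ (x∈p∩q⁻ p ⊥ x∈))
  disjoint-⋃ {p = p} (q ∷ ps) (d ∷ ds) (x , x∈) with x∈p∩q⁻ p (q ∪ ⋃ ps) x∈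
  ... | x∈p , x∈q∪ps with x∈p∪q⁻ q (⋃ ps) x∈q∪ps
  ...   | inj₁ x∈q  = d (x , x∈p∩q⁺ (x∈p , x∈q))
  ...   | inj₂ x∈ps = disjoint-⋃ ps ds (x , x∈p∩q⁺ (x∈p , x∈ps))

  ∣⋃∣≡k*length : (ps : List (Subset n)) → All (IsKSubset k) ps → AllPairs Disjoint ps →
                 ∣ ⋃ ps ∣ ≡ k * length ps
  ∣⋃∣≡k*length {n} {k} [] [] [] = trans (∣⊥∣≡0 n) (sym (*-zeroʳ k))
  ∣⋃∣≡k*length {n} {k} (p ∷ ps) (∣p∣≡k ∷ sizes) (d ∷ ds) = begin
    ∣ p ∪ ⋃ ps ∣          ≡⟨ ∣p∪q∣≡∣p∣+∣q∣ p (⋃ ps) (disjoint-⋃ ps d) ⟩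
    ∣ p ∣ + ∣ ⋃ ps ∣      ≡⟨ cong₂ _+_ ∣p∣≡k (∣⋃∣≡k*length ps sizes ds) ⟩
    k + k * length ps     ≡⟨ *-suc k (length ps) ⟨
    k * suc (length ps)   ∎
    where open ≡-Reasoning

  length-filter-∈ : {x : Fin n} (ps : List (Subset n)) → AllPairs Disjoint ps → x ∈ ⋃ ps →
                    length (filter (x ∈?_) ps) ≡ 1
  length-filter-∈ [] [] x∈ = ⊥-elim (∉⊥ x∈)
  length-filter-∈ {x = x} (p ∷ ps) (d ∷ ds) x∈ with x∈p∪q⁻ p (⋃ ps) x∈
  ... | inj₁ x∈p = trans (cong length (filter-accept (x ∈?_) x∈p)) (cong (suc ∘ length)
        (filter-none (x ∈?_) (All.map (λ dq x∈q → dq (x , x∈p∩q⁺ (x∈p , x∈q))) d)))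
  ... | inj₂ x∈ps = trans (cong length (filter-reject (x ∈?_)
        (λ x∈p → disjoint-⋃ ps d (x , x∈p∩q⁺ (x∈p , x∈ps))))) (length-filter-∈ ps ds x∈ps)

  ∈-elems⁺ : {A : Subset n} {x : Fin n} → x ∈ A → x ∈ₗ elems A
  ∈-elems⁺ {A = A} {x} x∈A = ∈-filter⁺ (_∈? A) (∈-allFin x) x∈A

  ∈-elems⁻ : {A : Subset n} {x : Fin n} → x ∈ₗ elems A → x ∈ A
  ∈-elems⁻ {n} {A} x∈ = proj₂ (∈-filter⁻ (_∈? A) {xs = allFin n} x∈)

  elems-unique : (A : Subset n) → Unique (elems A)
  elems-unique {n} A = Unique.filter⁺ (_∈? A) (Unique.allFin⁺ n)

  length-filter-∈?-suc : ∀ {m} b (A : Subset n) (g : Fin m → Fin n) →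
                         length (filter (_∈? b ∷ A) (List.tabulate (suc ∘ g))) ≡
                         length (filter (_∈? A) (List.tabulate g))
  length-filter-∈?-suc {m = zero}  b A g = refl
  length-filter-∈?-suc {m = suc m} b A g with does (g zero ∈? A)
  ... | true  = cong suc (length-filter-∈?-suc b A (g ∘ suc))
  ... | false = length-filter-∈?-suc b A (g ∘ suc)

  length-elems : (A : Subset n) → length (elems A) ≡ ∣ A ∣
  length-elems []          = refl
  length-elems (true  ∷ A) = cong suc (trans (length-filter-∈?-suc true A id) (length-elems A))
  length-elems (false ∷ A) = trans (length-filter-∈?-suc false A id) (length-elems A)

  subsets : (n k : ℕ) → List (Subset n)
  subsets zero    zero    = [] ∷ []
  subsets zero    (suc k) = []
  subsets (suc n) zero    = map (false ∷_) (subsets n zero)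
  subsets (suc n) (suc k) = map (true ∷_) (subsets n k) ++ map (false ∷_) (subsets n (suc k))

  length-subsets : ∀ n k → length (subsets n k) ≡ n C k
  length-subsets zero    zero    = refl
  length-subsets zero    (suc k) = refl
  length-subsets (suc n) zero    = trans (length-map _ (subsets n zero)) (length-subsets n zero)
  length-subsets (suc n) (suc k) = begin
    length (map (true ∷_) (subsets n k) ++ map (false ∷_) (subsets n (suc k)))
      ≡⟨ length-++ (map (true ∷_) (subsets n k)) ⟩
    length (map (true ∷_) (subsets n k)) + length (map (false ∷_) (subsets n (suc k)))
      ≡⟨ cong₂ _+_ (length-map _ (subsets n k)) (length-map _ (subsets n (suc k))) ⟩
    length (subsets n k) + length (subsets n (suc k))
      ≡⟨ cong₂ _+_ (length-subsets n k) (length-subsets n (suc k)) ⟩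
    n C k + n C suc k
      ≡⟨ nCk+nC[k+1]≡[n+1]C[k+1] n k ⟩
    suc n C suc k ∎
    where open ≡-Reasoning

  ∈-subsets⁺ : ∀ {n k} {A : Subset n} → ∣ A ∣ ≡ k → A ∈ₗ subsets n k
  ∈-subsets⁺ {k = zero}  {[]}        _ = here refl
  ∈-subsets⁺ {k = suc k} {true ∷ A}  e = ∈-++⁺ˡ (∈-map⁺ (true ∷_) (∈-subsets⁺ (suc-injective e)))
  ∈-subsets⁺ {k = zero}  {false ∷ A} e = ∈-map⁺ (false ∷_) (∈-subsets⁺ e)
  ∈-subsets⁺ {suc n} {suc k} {false ∷ A} e =
    ∈-++⁺ʳ (map (true ∷_) (subsets n k)) (∈-map⁺ (false ∷_) (∈-subsets⁺ e))

  ∈-subsets⁻ : ∀ n k {A : Subset n} → A ∈ₗ subsets n k → ∣ A ∣ ≡ k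
  ∈-subsets⁻ zero    zero    (here refl) = refl
  ∈-subsets⁻ (suc n) zero    A∈ with ∈-map⁻ (false ∷_) A∈
  ... | _ , A′∈ , refl = ∈-subsets⁻ n zero A′∈
  ∈-subsets⁻ (suc n) (suc k) A∈ with ∈-++⁻ (map (true ∷_) (subsets n k)) A∈
  ... | inj₁ A∈₁ with ∈-map⁻ (true ∷_) A∈₁
  ...   | _ , A′∈ , refl = cong suc (∈-subsets⁻ n k A′∈)
  ∈-subsets⁻ (suc n) (suc k) A∈ | inj₂ A∈₂ with ∈-map⁻ (false ∷_) A∈₂
  ...   | _ , A′∈ , refl = ∈-subsets⁻ n (suc k) A′∈

  subsets-unique : ∀ n k → Unique (subsets n k)
  subsets-unique zero    zero    = [] ∷ []
  subsets-unique zero    (suc k) = []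
  subsets-unique (suc n) zero    = Unique.map⁺ ∷-injectiveʳ (subsets-unique n zero)
  subsets-unique (suc n) (suc k) = Unique.++⁺
    (Unique.map⁺ ∷-injectiveʳ (subsets-unique n k))
    (Unique.map⁺ ∷-injectiveʳ (subsets-unique n (suc k)))
    (λ (A∈₁ , A∈₂) → heads-differ (∈-map⁻ (true ∷_) A∈₁) (∈-map⁻ (false ∷_) A∈₂))
    where
    heads-differ : {A : Subset (suc n)} → (∃ λ A₁ → _ × A ≡ true ∷ A₁) → ¬ (∃ λ A₂ → _ × A ≡ false ∷ A₂)
    heads-differ (_ , _ , refl) (_ , _ , ())

  lookup-inject₁ : {A : Set} (B : Vec A (suc n)) (x : Fin n) → lookup B (inject₁ x) ≡ lookup (init B) x
  lookup-inject₁ (b ∷ B@(_ ∷ _)) zero    = refl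
  lookup-inject₁ (b ∷ B@(_ ∷ _)) (suc x) = lookup-inject₁ B x

  lookup-fromℕ : {A : Set} (B : Vec A (suc n)) → lookup B (fromℕ n) ≡ last B
  lookup-fromℕ (b ∷ [])       = refl
  lookup-fromℕ (b ∷ B@(_ ∷ _)) = lookup-fromℕ B

  init∷ʳlast : {A : Set} (B : Vec A (suc n)) → init B ∷ʳ last B ≡ B
  init∷ʳlast B = sym (proj₂ (proj₂ (initLast B)))

  ∣init∣≡∣B∣ : (B : Subset (suc n)) → last B ≡ false → ∣ init B ∣ ≡ ∣ B ∣
  ∣init∣≡∣B∣ (false ∷ [])        _ = refl
  ∣init∣≡∣B∣ (true  ∷ B@(_ ∷ _)) e = cong suc (∣init∣≡∣B∣ B e)
  ∣init∣≡∣B∣ (false ∷ B@(_ ∷ _)) e = ∣init∣≡∣B∣ B e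

  suc∣init∣≡∣B∣ : (B : Subset (suc n)) → last B ≡ true → suc ∣ init B ∣ ≡ ∣ B ∣
  suc∣init∣≡∣B∣ (true  ∷ [])        _ = refl
  suc∣init∣≡∣B∣ (true  ∷ B@(_ ∷ _)) e = cong suc (suc∣init∣≡∣B∣ B e)
  suc∣init∣≡∣B∣ (false ∷ B@(_ ∷ _)) e = suc∣init∣≡∣B∣ B e

  inject₁∈⇒∈init : {B : Subset (suc n)} {x : Fin n} → inject₁ x ∈ B → x ∈ init B
  inject₁∈⇒∈init {B = B} {x} x∈ = lookup⇒[]= x (init B) (trans (sym (lookup-inject₁ B x)) ([]=⇒lookup x∈))

  ∈init⇒inject₁∈ : {B : Subset (suc n)} {x : Fin n} → x ∈ init B → inject₁ x ∈ B
  ∈init⇒inject₁∈ {B = B} {x} x∈ = lookup⇒[]= (inject₁ x) B (trans (lookup-inject₁ B x) ([]=⇒lookup x∈))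

  fromℕ∈⇒last : {B : Subset (suc n)} → fromℕ n ∈ B → last B ≡ true
  fromℕ∈⇒last {B = B} Ω∈ = trans (sym (lookup-fromℕ B)) ([]=⇒lookup Ω∈)

  last≡false⇒fromℕ∉ : {B : Subset (suc n)} → last B ≡ false → fromℕ n ∉ B
  last≡false⇒fromℕ∉ Ω∉B Ω∈B with trans (sym (fromℕ∈⇒last Ω∈B)) Ω∉B
  ... | ()

  last⇒fromℕ∈ : {B : Subset (suc n)} → last B ≡ true → fromℕ n ∈ B
  last⇒fromℕ∈ {n} {B} e = lookup⇒[]= (fromℕ n) B (trans (lookup-fromℕ B) e)

  lookup-map-∈ : ∀ {m n} {f : List (Subset m) → List (Subset n)} {S x y} →
                 All (λ R → y ∈ₗ f R → x ∈ₗ R) S → (j : Fin (length (map f S))) →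
                 y ∈ₗ List.lookup (map f S) j → ∃ λ j′ → x ∈ₗ List.lookup S j′
  lookup-map-∈ (y⇒x ∷ _)  zero    y∈ = zero , y⇒x y∈
  lookup-map-∈ (_ ∷ y⇒xs) (suc j) y∈ = Product.map suc id (lookup-map-∈ y⇒xs j y∈)

  ExactlyOneClass-map : ∀ {m n} (f : List (Subset m) → List (Subset n)) {S x y} →
                        All (λ R → y ∈ₗ f R → x ∈ₗ R) S → (∀ {R} → x ∈ₗ R → y ∈ₗ f R) →
                        ExactlyOneClass S x → ExactlyOneClass (map f S) y
  ExactlyOneClass-map f {R ∷ S} (_ ∷ y⇒xs) x⇒y (zero , x∈R , unique) = zero , x⇒y x∈R , unique′
    where
    unique′ : ∀ j → _ ∈ₗ List.lookup (map f (R ∷ S)) j → j ≡ zero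
    unique′ zero    _  = refl
    unique′ (suc j) y∈ with lookup-map-∈ y⇒xs j y∈
    ... | j′ , x∈ with unique (suc j′) x∈
    ... | ()
  ExactlyOneClass-map f {R ∷ S} (y⇒x ∷ y⇒xs) x⇒y (suc i , x∈ , unique)
    with ExactlyOneClass-map f y⇒xs x⇒y (i , x∈ , λ j x∈j → Fin.suc-injective (unique (suc j) x∈j))
  ... | i′ , y∈ , unique′ = suc i′ , y∈ , unique″
    where
    unique″ : ∀ j → _ ∈ₗ List.lookup (map f (R ∷ S)) j → j ≡ suc i′
    unique″ zero    y∈R with unique zero (y⇒x y∈R)
    ... | ()
    unique″ (suc j) y∈  = cong suc (unique′ j y∈)

  placed-once⇒disjoint : {A : Set} {S : List (List A)} →
                         (∀ {x} i j → x ∈ₗ List.lookup S i → x ∈ₗ List.lookup S j → i ≡ j) →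
                         AllPairs Disjointₗ S
  placed-once⇒disjoint {S = []}    _    = []
  placed-once⇒disjoint {S = R ∷ S} once =
    All.tabulate (λ R′∈S (x∈R , x∈R′) → case once zero (suc (Any.index R′∈S)) x∈R
                                            (subst (_ ∈ₗ_) (lookup-index R′∈S) x∈R′) of λ ())
    ∷ placed-once⇒disjoint (λ i j x∈i x∈j → Fin.suc-injective (once (suc i) (suc j) x∈i x∈j))

  BP⇒placed-once : ∀ {n S} → BP n S → ∀ {B} i j → B ∈ₗ List.lookup S i → B ∈ₗ List.lookup S j → i ≡ j
  BP⇒placed-once (classes , exactly-one) i j B∈i B∈j
    with exactly-one _ (All.lookup (proj₁ (All.lookup classes (∈-lookup i))) B∈i)
  ... | _ , _ , unique = trans (unique i B∈i) (sym (unique j B∈j))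

  -- The point set Z_t × Z_4

  ∣tabulate∣-+ : ∀ m {n} (f : Fin (m + n) → Bool) →
                 ∣ tabulate f ∣ ≡ ∣ tabulate (f ∘ (_↑ˡ n)) ∣ + ∣ tabulate (f ∘ (m ↑ʳ_)) ∣
  ∣tabulate∣-+ zero    f = refl
  ∣tabulate∣-+ (suc m) f with f zero
  ... | true  = cong suc (∣tabulate∣-+ m (f ∘ suc))
  ... | false = ∣tabulate∣-+ m (f ∘ suc)

  layer-combine : ∀ {t} (x : Fin t) (l : Fin 4) → layer {t} (combine x l) ≡ l
  layer-combine x l = cong proj₂ (remQuot-combine x l)

  quotient-combine : ∀ {t} (x : Fin t) (l : Fin 4) → quotient {t} 4 (combine x l) ≡ x
  quotient-combine x l = cong proj₁ (remQuot-combine x l)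

  combine-quotient-layer : ∀ {t} (k : Fin (t * 4)) → combine (quotient {t} 4 k) (layer {t} k) ≡ k
  combine-quotient-layer {t} k = combine-remQuot {t} 4 k

  ∀-combine : ∀ {t} {P : Fin (t * 4) → Set} → (∀ x l → P (combine x l)) → ∀ k → P k
  ∀-combine {t} {P} h k = subst P (combine-quotient-layer {t} k) (h (quotient {t} 4 k) (layer {t} k))

  lookup-atLayer : ∀ {t} (A : Subset t) (i : Fin 4) (x : Fin t) (l : Fin 4) →
                   lookup (atLayer A i) (combine x l) ≡ lookup A x ∧ ⌊ l ≟ i ⌋
  lookup-atLayer A i x l = trans (lookup∘tabulate _ (combine x l))
    (cong (λ p → lookup A (proj₁ p) ∧ ⌊ proj₂ p ≟ i ⌋) (remQuot-combine x l))

  ∈-atLayer⁺ : ∀ {t} {A : Subset t} {x : Fin t} (i : Fin 4) → x ∈ A → combine x i ∈ atLayer A i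
  ∈-atLayer⁺ {A = A} {x} i x∈A = lookup⇒[]= (combine x i) (atLayer A i)
    (trans (lookup-atLayer A i x i) (cong₂ _∧_ ([]=⇒lookup x∈A) (⌊⌋-true⁺ (i ≟ i) refl)))

  ∈-atLayer⁻ : ∀ {t} (A : Subset t) (i : Fin 4) {k : Fin (t * 4)} → k ∈ atLayer A i →
               quotient {t} 4 k ∈ A × layer {t} k ≡ i
  ∈-atLayer⁻ {t} A i {k} k∈ =
      lookup⇒[]= (quotient {t} 4 k) A (∧-conicalˡ _ _ k∈A∧)
    , ⌊⌋-true⁻ (layer {t} k ≟ i) (∧-conicalʳ _ _ k∈A∧)
    where k∈A∧ = ∈-tabulate⁻ k∈

  -- The first row of Fin (suc t * 4) is combine zero, the others are 4 ↑ʳ combine x l.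
  ∣atLayer∣ : ∀ {t} (A : Subset t) (i : Fin 4) → ∣ atLayer A i ∣ ≡ ∣ A ∣
  ∣atLayer∣ {zero}  []      i = refl
  ∣atLayer∣ {suc t} (a ∷ A) i = begin
    ∣ atLayer (a ∷ A) i ∣
      ≡⟨ ∣tabulate∣-+ 4 {t * 4} f ⟩
    ∣ tabulate (f ∘ combine {suc t} zero) ∣ + ∣ tabulate (f ∘ (4 ↑ʳ_)) ∣
      ≡⟨ cong₂ (λ p q → ∣ p ∣ + ∣ q ∣) (tabulate-cong first-row) (tabulate-cong other-rows) ⟩
    ∣ tabulate (λ l → a ∧ ⌊ l ≟ i ⌋) ∣ + ∣ tabulate (lookup (atLayer A i)) ∣
      ≡⟨ cong₂ _+_ (∣row∣ a i) (trans (cong ∣_∣ (tabulate∘lookup (atLayer A i))) (∣atLayer∣ A i)) ⟩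
    ∣ a ∷ [] ∣ + ∣ A ∣
      ≡⟨ ∣a∷[]∣+∣A∣ a ⟩
    ∣ a ∷ A ∣ ∎
    where
    open ≡-Reasoning
    f : Fin (suc t * 4) → Bool
    f k = lookup (a ∷ A) (quotient {suc t} 4 k) ∧ ⌊ layer {suc t} k ≟ i ⌋
    first-row : ∀ l → f (combine {suc t} zero l) ≡ a ∧ ⌊ l ≟ i ⌋
    first-row l = trans (sym (lookup∘tabulate f (combine {suc t} zero l))) (lookup-atLayer (a ∷ A) i zero l)
    other-rows : ∀ k → f (4 ↑ʳ k) ≡ lookup (atLayer A i) k
    other-rows = ∀-combine λ x l → trans (sym (lookup∘tabulate f (combine (suc x) l)))
      (trans (lookup-atLayer (a ∷ A) i (suc x) l) (sym (lookup-atLayer A i x l)))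
    ∣row∣ : ∀ a (i : Fin 4) → ∣ tabulate (λ l → a ∧ ⌊ l ≟ i ⌋) ∣ ≡ ∣ a ∷ [] ∣
    ∣row∣ false i = refl
    ∣row∣ true zero = refl
    ∣row∣ true (suc zero) = refl
    ∣row∣ true (suc (suc zero)) = refl
    ∣row∣ true (suc (suc (suc zero))) = refl
    ∣a∷[]∣+∣A∣ : ∀ a → ∣ a ∷ [] ∣ + ∣ A ∣ ≡ ∣ a ∷ A ∣
    ∣a∷[]∣+∣A∣ true  = refl
    ∣a∷[]∣+∣A∣ false = refl

  module _ {t : ℕ} where

    private
      layerSet : Fin 4 → Subset (t * 4)
      layerSet j = tabulate λ k → ⌊ layer {t} k ≟ j ⌋

    layerCount-all : {P : Subset (t * 4)} {j : Fin 4} → (∀ {k} → k ∈ P → layer {t} k ≡ j) →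
                     layerCount {t} P j ≡ ∣ P ∣
    layerCount-all {P} {j} P⊆j = cong ∣_∣ (⊆-antisym (p∩q⊆p P (layerSet j))
      (λ k∈P → x∈p∩q⁺ (k∈P , ∈-tabulate⁺ (⌊⌋-true⁺ (_ ≟ j) (P⊆j k∈P)))))

    layerCount-none : {P : Subset (t * 4)} {j : Fin 4} → (∀ {k} → k ∈ P → layer {t} k ≢ j) →
                      layerCount {t} P j ≡ 0
    layerCount-none {P} {j} P∩j≡∅ = trans (cong ∣_∣ (Empty-unique empty)) (∣⊥∣≡0 (t * 4))
      where
      empty : Empty (P ∩ layerSet j)
      empty (k , k∈) with x∈p∩q⁻ P (layerSet j) k∈
      ... | k∈P , k∈j = P∩j≡∅ k∈P (⌊⌋-true⁻ (layer {t} k ≟ j) (∈-tabulate⁻ k∈j))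

    layerCount-∪ : (P Q : Subset (t * 4)) (j : Fin 4) → Disjoint P Q →
                   layerCount {t} (P ∪ Q) j ≡ layerCount {t} P j + layerCount {t} Q j
    layerCount-∪ P Q j P∩Q≡∅ = trans (cong ∣_∣ (∩-distribʳ-∪ (layerSet j) P Q))
      (∣p∪q∣≡∣p∣+∣q∣ (P ∩ layerSet j) (Q ∩ layerSet j) λ (k , k∈) →
        P∩Q≡∅ (k , x∈p∩q⁺ (p∩q⊆p P _ (p∩q⊆p _ _ k∈) , p∩q⊆p Q _ (p∩q⊆q _ _ k∈))))

    pointed : Subset t → Fin 4 → Fin t → Subset (t * 4)
    pointed A i y = atLayer A i ∪ ⁅ combine y (# 3) ⁆

    ∈-pointed⁻ : (A : Subset t) (i : Fin 4) (y : Fin t) {k : Fin (t * 4)} → k ∈ pointed A i y →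
                 (quotient {t} 4 k ∈ A × layer {t} k ≡ i) ⊎ k ≡ combine y (# 3)
    ∈-pointed⁻ A i y k∈ with x∈p∪q⁻ (atLayer A i) _ k∈
    ... | inj₁ k∈A×i = inj₁ (∈-atLayer⁻ A i k∈A×i)
    ... | inj₂ k∈⁅y3⁆ = inj₂ (x∈⁅y⁆⇒x≡y _ k∈⁅y3⁆)

    base∈pointed : {A : Subset t} {x y : Fin t} {i : Fin 4} → x ∈ A → combine x i ∈ pointed A i y
    base∈pointed x∈A = x∈p∪q⁺ (inj₁ (∈-atLayer⁺ _ x∈A))

    apex∈pointed : (A : Subset t) {y : Fin t} {i : Fin 4} → combine y (# 3) ∈ pointed A i y
    apex∈pointed _ = x∈p∪q⁺ (inj₂ (x∈⁅x⁆ _))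

    pointed-over : (A : Subset t) (i : Fin 4) {y : Fin t} {k : Fin (t * 4)} → y ∈ A →
                   k ∈ pointed A i y → quotient {t} 4 k ∈ A
    pointed-over A i {y} y∈A k∈ with ∈-pointed⁻ A i y k∈
    ... | inj₁ (q∈A , _) = q∈A
    ... | inj₂ refl      = subst (_∈ _) (sym (quotient-combine _ _)) y∈A

    disjoint-atLayer : (A : Subset t) {i j : Fin 4} → i ≢ j → Disjoint (atLayer A i) (atLayer A j)
    disjoint-atLayer A {i} {j} i≢j (k , k∈) with x∈p∩q⁻ (atLayer A i) (atLayer A j) k∈
    ... | k∈i , k∈j = i≢j (trans (sym (proj₂ (∈-atLayer⁻ A i k∈i))) (proj₂ (∈-atLayer⁻ A j k∈j)))

    disjoint-pointed : (A : Subset t) {i j : Fin 4} {y y′ : Fin t} → i ≢ j → i ≢ # 3 → j ≢ # 3 →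
                       y ≢ y′ → Disjoint (pointed A i y) (pointed A j y′)
    disjoint-pointed A {i} {j} {y} {y′} i≢j i≢3 j≢3 y≢y′ (k , k∈)
      with x∈p∩q⁻ (pointed A i y) (pointed A j y′) k∈
    ... | k∈i , k∈j with ∈-pointed⁻ A i y k∈i | ∈-pointed⁻ A j y′ k∈j
    ... | inj₁ (_ , k∈i) | inj₁ (_ , k∈j) = i≢j (trans (sym k∈i) k∈j)
    ... | inj₁ (_ , k∈i) | inj₂ refl      = i≢3 (trans (sym k∈i) (layer-combine y′ (# 3)))
    ... | inj₂ refl      | inj₁ (_ , k∈j) = j≢3 (trans (sym k∈j) (layer-combine y (# 3)))
    ... | inj₂ refl      | inj₂ k≡        = y≢y′ (combine-injectiveˡ y (# 3) y′ (# 3) k≡)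

    layer-apex : (y : Fin t) {k : Fin (t * 4)} → k ∈ ⁅ combine y (# 3) ⁆ → layer {t} k ≡ # 3
    layer-apex y k∈ = trans (cong (layer {t}) (x∈⁅y⁆⇒x≡y _ k∈)) (layer-combine y (# 3))

    disjoint-apex : (A : Subset t) {i : Fin 4} (y : Fin t) → i ≢ # 3 →
                    Disjoint (atLayer A i) ⁅ combine y (# 3) ⁆
    disjoint-apex A {i} y i≢3 (k , k∈) with x∈p∩q⁻ (atLayer A i) _ k∈
    ... | k∈A×i , k∈apex = i≢3 (trans (sym (proj₂ (∈-atLayer⁻ A i k∈A×i))) (layer-apex y k∈apex))

    ∣pointed∣ : (A : Subset t) {i : Fin 4} (y : Fin t) → i ≢ # 3 → ∣ pointed A i y ∣ ≡ ∣ A ∣ + 1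
    ∣pointed∣ A {i} y i≢3 = begin
      ∣ atLayer A i ∪ ⁅ combine y (# 3) ⁆ ∣       ≡⟨ ∣p∪q∣≡∣p∣+∣q∣ _ _ (disjoint-apex A y i≢3) ⟩
      ∣ atLayer A i ∣ + ∣ ⁅ combine y (# 3) ⁆ ∣  ≡⟨ cong₂ _+_ (∣atLayer∣ A i) (∣⁅x⁆∣≡1 (combine y (# 3))) ⟩
      ∣ A ∣ + 1                                   ∎
      where open ≡-Reasoning

    sameLayer-atLayer : (A : Subset t) (i : Fin 4) → SameLayer {t} (atLayer A i)
    sameLayer-atLayer A i = i , λ k k∈ → proj₂ (∈-atLayer⁻ A i k∈)

    ¬sameLayer-pointed : (A : Subset t) (i : Fin 4) {y : Fin t} → y ∈ A → i ≢ # 3 →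
                         ¬ SameLayer {t} (pointed A i y)
    ¬sameLayer-pointed A i {y} y∈A i≢3 (j , on-j) = i≢3 (begin
      i                        ≡⟨ layer-combine y i ⟨
      layer {t} (combine y i)  ≡⟨ on-j _ (base∈pointed y∈A) ⟩
      j                        ≡⟨ on-j _ (apex∈pointed A) ⟨
      layer {t} (combine y (# 3)) ≡⟨ layer-combine y (# 3) ⟩
      # 3                      ∎)
      where open ≡-Reasoning

    threeOne-pointed : (A : Subset t) (i : Fin 4) (y : Fin t) → ∣ A ∣ ≡ 3 → i ≢ # 3 →
                       ThreeOne {t} (pointed A i y)
    threeOne-pointed A i y ∣A∣≡3 i≢3 = i , # 3 , i≢3 , count-i , count-3
      where
      open ≡-Reasoning
      apex = ⁅ combine y (# 3) ⁆
      count-i : layerCount {t} (pointed A i y) i ≡ 3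
      count-i = begin
        layerCount {t} (atLayer A i ∪ apex) i
          ≡⟨ layerCount-∪ (atLayer A i) apex i (disjoint-apex A y i≢3) ⟩
        layerCount {t} (atLayer A i) i + layerCount {t} apex i
          ≡⟨ cong₂ _+_ (layerCount-all (proj₂ ∘ ∈-atLayer⁻ A i))
                       (layerCount-none λ k∈ k∈i → i≢3 (trans (sym k∈i) (layer-apex y k∈))) ⟩
        ∣ atLayer A i ∣ + 0
          ≡⟨ trans (+-identityʳ _) (∣atLayer∣ A i) ⟩
        ∣ A ∣
          ≡⟨ ∣A∣≡3 ⟩
        3 ∎
      count-3 : layerCount {t} (pointed A i y) (# 3) ≡ 1
      count-3 = begin
        layerCount {t} (atLayer A i ∪ apex) (# 3)
          ≡⟨ layerCount-∪ (atLayer A i) apex (# 3) (disjoint-apex A y i≢3) ⟩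
        layerCount {t} (atLayer A i) (# 3) + layerCount {t} apex (# 3)
          ≡⟨ cong₂ _+_ (layerCount-none λ k∈ k∈3 → i≢3 (trans (sym (proj₂ (∈-atLayer⁻ A i k∈))) k∈3))
                       (layerCount-all (layer-apex y)) ⟩
        0 + ∣ apex ∣
          ≡⟨ ∣⁅x⁆∣≡1 (combine y (# 3)) ⟩
        1 ∎

    ¬threeOne-atLayer : (A : Subset t) (i : Fin 4) → ¬ ThreeOne {t} (atLayer A i)
    ¬threeOne-atLayer A i (j , j′ , j≢j′ , count-j , count-j′) =
      j≢j′ (trans (nonzero⇒i count-j) (sym (nonzero⇒i count-j′)))
      where
      nonzero⇒i : ∀ {l m} → layerCount {t} (atLayer A i) l ≡ suc m → l ≡ i
      nonzero⇒i {l} count with l ≟ i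
      ... | yes l≡i = l≡i
      ... | no  l≢i = contradiction (trans (sym (layerCount-none λ k∈ k∈l →
              l≢i (trans (sym k∈l) (proj₂ (∈-atLayer⁻ A i k∈))))) count) 0≢1+n

    shadow : Subset (t * 4) → Subset t
    shadow Q = tabulate λ x → ⌊ any? (λ l → combine x l ∈? Q) ⌋

    ∈-shadow⁺ : {Q : Subset (t * 4)} {x : Fin t} (l : Fin 4) → combine x l ∈ Q → x ∈ shadow Q
    ∈-shadow⁺ {Q} {x} l xl∈Q = ∈-tabulate⁺ (⌊⌋-true⁺ (any? λ l → combine x l ∈? Q) (l , xl∈Q))

    ∈-shadow⁻ : {Q : Subset (t * 4)} {x : Fin t} → x ∈ shadow Q → ∃ λ l → combine x l ∈ Q
    ∈-shadow⁻ {Q} {x} x∈ = ⌊⌋-true⁻ (any? λ l → combine x l ∈? Q) (∈-tabulate⁻ x∈)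

    shadow≡ : {Q : Subset (t * 4)} {A : Subset t} → (∀ {k} → k ∈ Q → quotient {t} 4 k ∈ A) →
              (∀ {x} → x ∈ A → ∃ λ l → combine x l ∈ Q) → shadow Q ≡ A
    shadow≡ {Q} {A} over onto = ⊆-antisym shadow⊆A (λ x∈A → ∈-shadow⁺ _ (proj₂ (onto x∈A)))
      where
      shadow⊆A : shadow Q ⊆ A
      shadow⊆A {x} x∈ with ∈-shadow⁻ x∈
      ... | l , xl∈Q = subst (_∈ A) (quotient-combine x l) (over xl∈Q)

    sameLayer⇒atLayer-shadow : {Q : Subset (t * 4)} ((i , _) : SameLayer {t} Q) → Q ≡ atLayer (shadow Q) i
    sameLayer⇒atLayer-shadow {Q} (i , on-i) = ⊆-antisym Q⊆ ⊆Q
      where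
      k≡combine-i : ∀ {k} → layer {t} k ≡ i → combine (quotient {t} 4 k) i ≡ k
      k≡combine-i {k} k∈i = trans (cong (combine (quotient {t} 4 k)) (sym k∈i)) (combine-quotient-layer {t} k)
      Q⊆ : Q ⊆ atLayer (shadow Q) i
      Q⊆ {k} k∈Q = subst (_∈ atLayer (shadow Q) i) (k≡combine-i (on-i k k∈Q))
        (∈-atLayer⁺ i (∈-shadow⁺ (layer {t} k) (subst (_∈ Q) (sym (combine-quotient-layer {t} k)) k∈Q)))
      ⊆Q : atLayer (shadow Q) i ⊆ Q
      ⊆Q {k} k∈ with ∈-atLayer⁻ (shadow Q) i k∈
      ... | q∈shadow , k∈i with ∈-shadow⁻ q∈shadow
      ...   | l , ql∈Q = subst (_∈ Q) (k≡combine-i k∈i)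
                (subst (λ l → combine q l ∈ Q) (trans (sym (layer-combine q l)) (on-i _ ql∈Q)) ql∈Q)
        where q = quotient {t} 4 k

    blockOf : Subset (t * 4) → Subset (suc t)
    blockOf Q = shadow Q ∷ʳ not ⌊ sameLayer? {t} Q ⌋

    blockOf-atLayer : (A : Subset t) (i : Fin 4) → blockOf (atLayer A i) ≡ A ∷ʳ false
    blockOf-atLayer A i = cong₂ _∷ʳ_
      (shadow≡ (proj₁ ∘ ∈-atLayer⁻ A i) (λ x∈A → i , ∈-atLayer⁺ i x∈A))
      (cong not (⌊⌋-true⁺ (sameLayer? {t} (atLayer A i)) (sameLayer-atLayer A i)))

    blockOf-pointed : (A : Subset t) (i : Fin 4) {y : Fin t} → y ∈ A → i ≢ # 3 →
                      blockOf (pointed A i y) ≡ A ∷ʳ true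
    blockOf-pointed A i y∈A i≢3 = cong₂ _∷ʳ_
      (shadow≡ (pointed-over A i y∈A) (λ x∈A → i , base∈pointed x∈A))
      (cong not (⌊⌋-false⁺ (sameLayer? {t} (pointed A i _)) (¬sameLayer-pointed A i y∈A i≢3)))


    -- The quadruples of a block

    Ω₁ : Fin (suc t)
    Ω₁ = fromℕ t

    layerCopies : Subset t → List (Subset (t * 4))
    layerCopies A = atLayer A (# 0) ∷ atLayer A (# 1) ∷ atLayer A (# 2) ∷ atLayer A (# 3) ∷ []

    pointedCopies : Subset t → Fin t → Fin t → Fin t → List (Subset (t * 4))
    pointedCopies A x₀ x₁ x₂ = pointed A (# 0) x₀ ∷ pointed A (# 1) x₁ ∷ pointed A (# 2) x₂ ∷ []

    blocks'-Ω∉ : (B : Subset (suc t)) → last B ≡ false → blocks' {t} B ≡ layerCopies (init B)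
    blocks'-Ω∉ B Ω∉B with last B
    blocks'-Ω∉ B refl | .false = refl

    blocks'-Ω∈ : (B : Subset (suc t)) {x₀ x₁ x₂ : Fin t} → last B ≡ true →
                 elems (init B) ≡ x₀ ∷ x₁ ∷ x₂ ∷ [] → blocks' {t} B ≡ pointedCopies (init B) x₀ x₁ x₂
    blocks'-Ω∈ B Ω∈B es with last B
    blocks'-Ω∈ B refl es | .true with elems (init B)
    blocks'-Ω∈ B refl refl | .true | ._ = refl

    data BlockShape (B : Subset (suc t)) : Set where
      Ω∉ : last B ≡ false → ∣ init B ∣ ≡ 4 → blocks' {t} B ≡ layerCopies (init B) → BlockShape B
      Ω∈ : ∀ {x₀ x₁ x₂} → last B ≡ true → ∣ init B ∣ ≡ 3 → elems (init B) ≡ x₀ ∷ x₁ ∷ x₂ ∷ [] →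
           blocks' {t} B ≡ pointedCopies (init B) x₀ x₁ x₂ → BlockShape B

    blockShape : (B : Subset (suc t)) → IsKSubset 4 B → BlockShape B
    blockShape B ∣B∣≡4 with last B in Ω?
    ... | false = Ω∉ Ω? (trans (∣init∣≡∣B∣ B Ω?) ∣B∣≡4) (blocks'-Ω∉ B Ω?)
    ... | true  = Ω∈ Ω? ∣init∣≡3 es (blocks'-Ω∈ B Ω? es)
      where
      ∣init∣≡3 = suc-injective (trans (suc∣init∣≡∣B∣ B Ω?) ∣B∣≡4)
      es = proj₂ (proj₂ (proj₂ (length≡3⇒ (elems (init B)) (trans (length-elems (init B)) ∣init∣≡3))))

    ∈-layerCopies⁻ : {A : Subset t} {Q : Subset (t * 4)} → Q ∈ₗ layerCopies A → ∃ λ i → Q ≡ atLayer A i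
    ∈-layerCopies⁻ (here Q≡)                         = _ , Q≡
    ∈-layerCopies⁻ (there (here Q≡))                 = _ , Q≡
    ∈-layerCopies⁻ (there (there (here Q≡)))         = _ , Q≡
    ∈-layerCopies⁻ (there (there (there (here Q≡)))) = _ , Q≡

    ∈-layerCopies⁺ : (A : Subset t) (i : Fin 4) → atLayer A i ∈ₗ layerCopies A
    ∈-layerCopies⁺ A zero                   = here refl
    ∈-layerCopies⁺ A (suc zero)             = there (here refl)
    ∈-layerCopies⁺ A (suc (suc zero))       = there (there (here refl))
    ∈-layerCopies⁺ A (suc (suc (suc zero))) = there (there (there (here refl)))

    ∈-pointedCopies⁻ : {A : Subset t} {x₀ x₁ x₂ : Fin t} {Q : Subset (t * 4)} →
                       Q ∈ₗ pointedCopies A x₀ x₁ x₂ →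
                       ∃ λ i → ∃ λ y → i ≢ # 3 × y ∈ₗ x₀ ∷ x₁ ∷ x₂ ∷ [] × Q ≡ pointed A i y
    ∈-pointedCopies⁻ (here Q≡)                 = # 0 , _ , (λ ()) , here refl , Q≡
    ∈-pointedCopies⁻ (there (here Q≡))         = # 1 , _ , (λ ()) , there (here refl) , Q≡
    ∈-pointedCopies⁻ (there (there (here Q≡))) = # 2 , _ , (λ ()) , there (there (here refl)) , Q≡

    layerCopies-sizes : (A : Subset t) → ∣ A ∣ ≡ 4 → All (IsKSubset 4) (layerCopies A)
    layerCopies-sizes A ∣A∣≡4 = All.tabulate size
      where
      size : ∀ {Q} → Q ∈ₗ layerCopies A → IsKSubset 4 Q
      size Q∈ with ∈-layerCopies⁻ {A = A} Q∈
      ... | i , refl = trans (∣atLayer∣ A i) ∣A∣≡4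

    pointedCopies-sizes : (A : Subset t) (x₀ x₁ x₂ : Fin t) → ∣ A ∣ ≡ 3 →
                          All (IsKSubset 4) (pointedCopies A x₀ x₁ x₂)
    pointedCopies-sizes A x₀ x₁ x₂ ∣A∣≡3 = All.tabulate size
      where
      size : ∀ {Q} → Q ∈ₗ pointedCopies A x₀ x₁ x₂ → IsKSubset 4 Q
      size Q∈ with ∈-pointedCopies⁻ {A = A} Q∈
      ... | i , y , i≢3 , _ , refl = trans (∣pointed∣ A y i≢3) (cong (_+ 1) ∣A∣≡3)

    layerCopies-disjoint : (A : Subset t) → AllPairs Disjoint (layerCopies A)
    layerCopies-disjoint A =
        (d (λ ()) ∷ d (λ ()) ∷ d (λ ()) ∷ [])
      ∷ (d (λ ()) ∷ d (λ ()) ∷ [])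
      ∷ (d (λ ()) ∷ [])
      ∷ [] ∷ []
      where
      d : {i j : Fin 4} → i ≢ j → Disjoint (atLayer A i) (atLayer A j)
      d = disjoint-atLayer A

    pointedCopies-disjoint : (A : Subset t) {x₀ x₁ x₂ : Fin t} → Unique (x₀ ∷ x₁ ∷ x₂ ∷ []) →
                             AllPairs Disjoint (pointedCopies A x₀ x₁ x₂)
    pointedCopies-disjoint A ((x₀≢x₁ ∷ x₀≢x₂ ∷ []) ∷ (x₁≢x₂ ∷ []) ∷ [] ∷ []) =
        (disjoint-pointed A (λ ()) (λ ()) (λ ()) x₀≢x₁ ∷ disjoint-pointed A (λ ()) (λ ()) (λ ()) x₀≢x₂ ∷ [])
      ∷ (disjoint-pointed A (λ ()) (λ ()) (λ ()) x₁≢x₂ ∷ [])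
      ∷ [] ∷ []

    layerCopies-over : {A : Subset t} {Q : Subset (t * 4)} {k : Fin (t * 4)} →
                       Q ∈ₗ layerCopies A → k ∈ Q → quotient {t} 4 k ∈ A
    layerCopies-over {A} Q∈ k∈Q with ∈-layerCopies⁻ {A = A} Q∈
    ... | i , refl = proj₁ (∈-atLayer⁻ A i k∈Q)

    pointedCopies-over : {A : Subset t} {x₀ x₁ x₂ : Fin t} {Q : Subset (t * 4)} {k : Fin (t * 4)} →
                         (∀ {y} → y ∈ₗ x₀ ∷ x₁ ∷ x₂ ∷ [] → y ∈ A) →
                         Q ∈ₗ pointedCopies A x₀ x₁ x₂ → k ∈ Q → quotient {t} 4 k ∈ A
    pointedCopies-over {A} xs⊆A Q∈ k∈Q with ∈-pointedCopies⁻ {A = A} Q∈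
    ... | i , y , _ , y∈xs , refl = pointed-over A i (xs⊆A y∈xs) k∈Q

    layerCopies-cover : {A : Subset t} {x : Fin t} → x ∈ A → ∀ l → Any (combine x l ∈_) (layerCopies A)
    layerCopies-cover x∈A zero                   = here (∈-atLayer⁺ _ x∈A)
    layerCopies-cover x∈A (suc zero)             = there (here (∈-atLayer⁺ _ x∈A))
    layerCopies-cover x∈A (suc (suc zero))       = there (there (here (∈-atLayer⁺ _ x∈A)))
    layerCopies-cover x∈A (suc (suc (suc zero))) = there (there (there (here (∈-atLayer⁺ _ x∈A))))

    pointedCopies-cover : {A : Subset t} {x x₀ x₁ x₂ : Fin t} → x ∈ A → x ∈ₗ x₀ ∷ x₁ ∷ x₂ ∷ [] →
                          ∀ l → Any (combine x l ∈_) (pointedCopies A x₀ x₁ x₂)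
    pointedCopies-cover x∈A _ zero             = here (base∈pointed x∈A)
    pointedCopies-cover x∈A _ (suc zero)       = there (here (base∈pointed x∈A))
    pointedCopies-cover x∈A _ (suc (suc zero)) = there (there (here (base∈pointed x∈A)))
    pointedCopies-cover {A} _ x∈xs (suc (suc (suc zero))) = apex-cover x∈xs
      where
      apex-cover : ∀ {x} → x ∈ₗ _ ∷ _ ∷ _ ∷ [] → Any (combine x (# 3) ∈_) (pointedCopies A _ _ _)
      apex-cover (here refl)                 = here (apex∈pointed A)
      apex-cover (there (here refl))         = there (here (apex∈pointed A))
      apex-cover (there (there (here refl))) = there (there (here (apex∈pointed A)))

    layerCopies-sameLayer : (A : Subset t) → filter (sameLayer? {t}) (layerCopies A) ≡ layerCopies A
    layerCopies-sameLayer A = filter-all (sameLayer? {t}) {xs = layerCopies A}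
      (  sameLayer-atLayer A (# 0) ∷ sameLayer-atLayer A (# 1)
       ∷ sameLayer-atLayer A (# 2) ∷ sameLayer-atLayer A (# 3) ∷ [])

    layerCopies-threeOne : (A : Subset t) → filter (threeOne? {t}) (layerCopies A) ≡ []
    layerCopies-threeOne A = filter-none (threeOne? {t}) {xs = layerCopies A}
      (  ¬threeOne-atLayer A (# 0) ∷ ¬threeOne-atLayer A (# 1)
       ∷ ¬threeOne-atLayer A (# 2) ∷ ¬threeOne-atLayer A (# 3) ∷ [])

    pointedCopies-sameLayer : (A : Subset t) {x₀ x₁ x₂ : Fin t} → (∀ {y} → y ∈ₗ x₀ ∷ x₁ ∷ x₂ ∷ [] → y ∈ A) →
                              filter (sameLayer? {t}) (pointedCopies A x₀ x₁ x₂) ≡ []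
    pointedCopies-sameLayer A {x₀} {x₁} {x₂} xs⊆A = filter-none (sameLayer? {t}) {xs = pointedCopies A x₀ x₁ x₂}
      (  ¬sameLayer-pointed A (# 0) (xs⊆A (here refl)) (λ ())
       ∷ ¬sameLayer-pointed A (# 1) (xs⊆A (there (here refl))) (λ ())
       ∷ ¬sameLayer-pointed A (# 2) (xs⊆A (there (there (here refl)))) (λ ()) ∷ [])

    pointedCopies-threeOne : (A : Subset t) (x₀ x₁ x₂ : Fin t) → ∣ A ∣ ≡ 3 →
                             filter (threeOne? {t}) (pointedCopies A x₀ x₁ x₂) ≡ pointedCopies A x₀ x₁ x₂
    pointedCopies-threeOne A x₀ x₁ x₂ ∣A∣≡3 = filter-all (threeOne? {t}) {xs = pointedCopies A x₀ x₁ x₂}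
      (  threeOne-pointed A (# 0) x₀ ∣A∣≡3 (λ ())
       ∷ threeOne-pointed A (# 1) x₁ ∣A∣≡3 (λ ())
       ∷ threeOne-pointed A (# 2) x₂ ∣A∣≡3 (λ ()) ∷ [])

    blockOf-layerCopies : {A : Subset t} {Q : Subset (t * 4)} → Q ∈ₗ layerCopies A → blockOf Q ≡ A ∷ʳ false
    blockOf-layerCopies {A} Q∈ with ∈-layerCopies⁻ {A = A} Q∈
    ... | i , refl = blockOf-atLayer A i

    blockOf-pointedCopies : {A : Subset t} {x₀ x₁ x₂ : Fin t} {Q : Subset (t * 4)} →
                            (∀ {y} → y ∈ₗ x₀ ∷ x₁ ∷ x₂ ∷ [] → y ∈ A) →
                            Q ∈ₗ pointedCopies A x₀ x₁ x₂ → blockOf Q ≡ A ∷ʳ true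
    blockOf-pointedCopies {A} xs⊆A Q∈ with ∈-pointedCopies⁻ {A = A} Q∈
    ... | i , y , i≢3 , y∈xs , refl = blockOf-pointed A i (xs⊆A y∈xs) i≢3

    sameLayer-blockOf : {Q : Subset (t * 4)} → IsKSubset 4 Q → SameLayer {t} Q →
                        IsKSubset 4 (blockOf Q) × Q ∈ₗ blocks' {t} (blockOf Q)
    sameLayer-blockOf {Q} ∣Q∣≡4 Q-flat@(i , _) =
      ∣blockOf∣≡4 , subst₂ _∈ₗ_ (sym Q≡) (sym blocks'≡) (∈-layerCopies⁺ A i)
      where
      open ≡-Reasoning
      A = shadow Q
      Q≡ = sameLayer⇒atLayer-shadow Q-flat
      blockOf≡ : blockOf Q ≡ A ∷ʳ false
      blockOf≡ = cong (λ b → A ∷ʳ not b) (⌊⌋-true⁺ (sameLayer? {t} Q) Q-flat)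
      ∣blockOf∣≡4 : ∣ blockOf Q ∣ ≡ 4
      ∣blockOf∣≡4 = begin
        ∣ blockOf Q ∣              ≡⟨ cong ∣_∣ blockOf≡ ⟩
        ∣ A ∷ʳ false ∣             ≡⟨ ∣init∣≡∣B∣ (A ∷ʳ false) (last-∷ʳ false A) ⟨
        ∣ init (A ∷ʳ false) ∣      ≡⟨ cong ∣_∣ (init-∷ʳ false A) ⟩
        ∣ A ∣                      ≡⟨ ∣atLayer∣ A i ⟨
        ∣ atLayer A i ∣            ≡⟨ cong ∣_∣ Q≡ ⟨
        ∣ Q ∣                      ≡⟨ ∣Q∣≡4 ⟩
        4                          ∎
      blocks'≡ : blocks' {t} (blockOf Q) ≡ layerCopies A
      blocks'≡ = begin
        blocks' (blockOf Q)              ≡⟨ cong blocks' blockOf≡ ⟩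
        blocks' (A ∷ʳ false)             ≡⟨ blocks'-Ω∉ (A ∷ʳ false) (last-∷ʳ false A) ⟩
        layerCopies (init (A ∷ʳ false))  ≡⟨ cong layerCopies (init-∷ʳ false A) ⟩
        layerCopies A                    ∎

    module _ (B : Subset (suc t)) (∣B∣≡4 : IsKSubset 4 B) where

      private
        elems⊆ : ∀ {x₀ x₁ x₂} → elems (init B) ≡ x₀ ∷ x₁ ∷ x₂ ∷ [] → ∀ {y} → y ∈ₗ x₀ ∷ x₁ ∷ x₂ ∷ [] → y ∈ init B
        elems⊆ es y∈ = ∈-elems⁻ (subst (_ ∈ₗ_) (sym es) y∈)

      blocks'-sizes : All (IsKSubset 4) (blocks' {t} B)
      blocks'-sizes with blockShape B ∣B∣≡4
      ... | Ω∉ _ ∣A∣≡4 eq   = subst (All (IsKSubset 4)) (sym eq) (layerCopies-sizes (init B) ∣A∣≡4)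
      ... | Ω∈ _ ∣A∣≡3 _ eq = subst (All (IsKSubset 4)) (sym eq) (pointedCopies-sizes (init B) _ _ _ ∣A∣≡3)

      blocks'-disjoint : AllPairs Disjoint (blocks' {t} B)
      blocks'-disjoint with blockShape B ∣B∣≡4
      ... | Ω∉ _ _ eq    = subst (AllPairs Disjoint) (sym eq) (layerCopies-disjoint (init B))
      ... | Ω∈ _ _ es eq = subst (AllPairs Disjoint) (sym eq)
                             (pointedCopies-disjoint (init B) (subst Unique es (elems-unique (init B))))

      blocks'-over : ∀ {Q k} → Q ∈ₗ blocks' {t} B → k ∈ Q → inject₁ (quotient {t} 4 k) ∈ B
      blocks'-over Q∈ k∈Q with blockShape B ∣B∣≡4
      ... | Ω∉ _ _ eq    = ∈init⇒inject₁∈ (layerCopies-over {A = init B} (subst (_ ∈ₗ_) eq Q∈) k∈Q)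
      ... | Ω∈ _ _ es eq =
        ∈init⇒inject₁∈ (pointedCopies-over {A = init B} (elems⊆ es) (subst (_ ∈ₗ_) eq Q∈) k∈Q)

      blocks'-cover : ∀ {x} → x ∈ init B → ∀ l → Any (combine x l ∈_) (blocks' {t} B)
      blocks'-cover x∈ l with blockShape B ∣B∣≡4
      ... | Ω∉ _ _ eq    = subst (Any _) (sym eq) (layerCopies-cover x∈ l)
      ... | Ω∈ _ _ es eq = subst (Any _) (sym eq)
                             (pointedCopies-cover x∈ (subst (_ ∈ₗ_) es (∈-elems⁺ x∈)) l)

      blocks'-nonempty : ∃ λ Q → Q ∈ₗ blocks' {t} B
      blocks'-nonempty with blockShape B ∣B∣≡4
      ... | Ω∉ _ _ eq         = _ , subst (atLayer (init B) (# 0) ∈ₗ_) (sym eq) (here refl)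
      ... | Ω∈ {x₀} _ _ _ eq = _ , subst (pointed (init B) (# 0) x₀ ∈ₗ_) (sym eq) (here refl)

      blockOf-blocks' : ∀ {Q} → Q ∈ₗ blocks' {t} B → blockOf Q ≡ B
      blockOf-blocks' Q∈ with blockShape B ∣B∣≡4
      ... | Ω∉ Ω∉B _ eq    = trans (blockOf-layerCopies {A = init B} (subst (_ ∈ₗ_) eq Q∈))
                               (trans (cong (init B ∷ʳ_) (sym Ω∉B)) (init∷ʳlast B))
      ... | Ω∈ Ω∈B _ es eq = trans (blockOf-pointedCopies {A = init B} (elems⊆ es) (subst (_ ∈ₗ_) eq Q∈))
                               (trans (cong (init B ∷ʳ_) (sym Ω∈B)) (init∷ʳlast B))

      blocks'-layer-counts :
          (Ω₁ ∉ B × length (filter (sameLayer? {t}) (blocks' {t} B)) ≡ 4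
                  × length (filter (threeOne? {t}) (blocks' {t} B)) ≡ 0)
        ⊎ (Ω₁ ∈ B × length (filter (sameLayer? {t}) (blocks' {t} B)) ≡ 0
                  × length (filter (threeOne? {t}) (blocks' {t} B)) ≡ 3)
      blocks'-layer-counts with blockShape B ∣B∣≡4
      ... | Ω∉ Ω∉B _ eq = inj₁ (last≡false⇒fromℕ∉ Ω∉B
        , cong length (trans (cong (filter (sameLayer? {t})) eq) (layerCopies-sameLayer (init B)))
        , cong length (trans (cong (filter (threeOne? {t})) eq) (layerCopies-threeOne (init B))))
      ... | Ω∈ Ω∈B ∣A∣≡3 es eq = inj₂ (last⇒fromℕ∈ Ω∈B
        , cong length (trans (cong (filter (sameLayer? {t})) eq) (pointedCopies-sameLayer (init B) (elems⊆ es)))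
        , cong length (trans (cong (filter (threeOne? {t})) eq) (pointedCopies-threeOne (init B) _ _ _ ∣A∣≡3)))

    -- Derived classes

    blocks'-disjoint-across : {B B′ : Subset (suc t)} → IsKSubset 4 B → IsKSubset 4 B′ → Disjoint B B′ →
                              ∀ {Q Q′} → Q ∈ₗ blocks' {t} B → Q′ ∈ₗ blocks' {t} B′ → Disjoint Q Q′
    blocks'-disjoint-across {B} {B′} ∣B∣≡4 ∣B′∣≡4 B∩B′≡∅ {Q} {Q′} Q∈ Q′∈ (k , k∈) with x∈p∩q⁻ Q Q′ k∈
    ... | k∈Q , k∈Q′ = B∩B′≡∅ (_ , x∈p∩q⁺ (blocks'-over B ∣B∣≡4 Q∈ k∈Q , blocks'-over B′ ∣B′∣≡4 Q′∈ k∈Q′))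

    derived-parallel : {R : List (Subset (suc t))} → ParallelClass (suc t) R →
                       ParallelClass (t * 4) (derived {t} R)
    derived-parallel {R} (sizes , disjoint , ⋃R≡⊤) = derived-sizes , derived-disjoint , derived-covers
      where
      derived-sizes : All (IsKSubset 4) (derived {t} R)
      derived-sizes = AllP.concat⁺ (AllP.map⁺ (All.map (λ {B} → blocks'-sizes B) sizes))

      across : ∀ {R} → All (IsKSubset 4) R → AllPairs Disjoint R →
               AllPairs (λ B B′ → All (λ Q → All (Disjoint Q) (blocks' {t} B′)) (blocks' {t} B)) R
      across [] [] = []
      across (∣B∣≡4 ∷ sizes) (B∩R ∷ disjoint) =
        All.zipWith (λ (B∩B′≡∅ , ∣B′∣≡4) → All.tabulate λ Q∈ → All.tabulate λ Q′∈ →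
                       blocks'-disjoint-across ∣B∣≡4 ∣B′∣≡4 B∩B′≡∅ Q∈ Q′∈) (B∩R , sizes)
        ∷ across sizes disjoint

      derived-disjoint : AllPairs Disjoint (derived {t} R)
      derived-disjoint = AllPairsP.concat⁺ (AllP.map⁺ (All.map (λ {B} → blocks'-disjoint B) sizes))
                                           (AllPairsP.map⁺ (across sizes disjoint))

      derived-covers : ⋃ (derived {t} R) ≡ ⊤
      derived-covers = ⋃≡⊤ (derived {t} R) (∀-combine λ x l → x∈⋃⁺ (cover x l))
        where
        cover : ∀ x l → Any (combine x l ∈_) (derived {t} R)
        cover x l with find (x∈⋃⁻ R (subst (inject₁ x ∈_) (sym ⋃R≡⊤) ∈⊤))
        ... | B , B∈R , x∈B = AnyP.concatMap⁺ (blocks' {t})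
          (lose B∈R (blocks'-cover B (All.lookup sizes B∈R) (inject₁∈⇒∈init x∈B) l))

    length-filter-sameLayer-derived : {R : List (Subset (suc t))} → All (IsKSubset 4) R →
      length (filter (sameLayer? {t}) (derived {t} R)) + 4 * length (filter (Ω₁ ∈?_) R) ≡ 4 * length R
    length-filter-sameLayer-derived [] = refl
    length-filter-sameLayer-derived {B ∷ R} (∣B∣≡4 ∷ sizes)
      with blocks'-layer-counts B ∣B∣≡4
    ... | inj₁ (Ω₁∉B , count-B , _) = begin
      length (filter P (blocks' B ++ derived R)) + 4 * length (filter (Ω₁ ∈?_) (B ∷ R))
        ≡⟨ cong₂ _+_ (length-filter-++ P (blocks' B) (derived R))
                     (cong (λ xs → 4 * length xs) (filter-reject (Ω₁ ∈?_) Ω₁∉B)) ⟩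
      length (filter P (blocks' B)) + c + 4 * w   ≡⟨ cong (λ b → b + c + 4 * w) count-B ⟩
      4 + c + 4 * w                               ≡⟨ +-assoc 4 c (4 * w) ⟩
      4 + (c + 4 * w)                             ≡⟨ cong (4 +_) (length-filter-sameLayer-derived sizes) ⟩
      4 + 4 * length R                            ≡⟨ *-suc 4 (length R) ⟨
      4 * length (B ∷ R)                          ∎
      where
      open ≡-Reasoning
      P = sameLayer? {t}
      c = length (filter P (derived R))
      w = length (filter (Ω₁ ∈?_) R)
    ... | inj₂ (Ω₁∈B , count-B , _) = begin
      length (filter P (blocks' B ++ derived R)) + 4 * length (filter (Ω₁ ∈?_) (B ∷ R))
        ≡⟨ cong₂ _+_ (length-filter-++ P (blocks' B) (derived R))
                     (cong (λ xs → 4 * length xs) (filter-accept (Ω₁ ∈?_) Ω₁∈B)) ⟩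
      length (filter P (blocks' B)) + c + 4 * suc w ≡⟨ cong (λ b → b + c + 4 * suc w) count-B ⟩
      c + 4 * suc w                                 ≡⟨ cong (c +_) (*-suc 4 w) ⟩
      c + (4 + 4 * w)                               ≡⟨ x∙yz≈y∙xz +-commutativeSemigroup c 4 (4 * w) ⟩
      4 + (c + 4 * w)                               ≡⟨ cong (4 +_) (length-filter-sameLayer-derived sizes) ⟩
      4 + 4 * length R                              ≡⟨ *-suc 4 (length R) ⟨
      4 * length (B ∷ R)                            ∎
      where
      open ≡-Reasoning
      P = sameLayer? {t}
      c = length (filter P (derived R))
      w = length (filter (Ω₁ ∈?_) R)

    length-filter-threeOne-derived : {R : List (Subset (suc t))} → All (IsKSubset 4) R →
      length (filter (threeOne? {t}) (derived {t} R)) ≡ 3 * length (filter (Ω₁ ∈?_) R)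
    length-filter-threeOne-derived [] = refl
    length-filter-threeOne-derived {B ∷ R} (∣B∣≡4 ∷ sizes)
      with blocks'-layer-counts B ∣B∣≡4
    ... | inj₁ (Ω₁∉B , _ , count-B) = begin
      length (filter P (blocks' B ++ derived R))  ≡⟨ length-filter-++ P (blocks' B) (derived R) ⟩
      length (filter P (blocks' B)) + c           ≡⟨ cong (_+ c) count-B ⟩
      c                                           ≡⟨ length-filter-threeOne-derived sizes ⟩
      3 * length (filter (Ω₁ ∈?_) R)              ≡⟨ cong (λ xs → 3 * length xs) (filter-reject (Ω₁ ∈?_) Ω₁∉B) ⟨
      3 * length (filter (Ω₁ ∈?_) (B ∷ R))        ∎
      where
      open ≡-Reasoning
      P = threeOne? {t}
      c = length (filter P (derived R))
    ... | inj₂ (Ω₁∈B , _ , count-B) = begin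
      length (filter P (blocks' B ++ derived R))  ≡⟨ length-filter-++ P (blocks' B) (derived R) ⟩
      length (filter P (blocks' B)) + c           ≡⟨ cong (_+ c) count-B ⟩
      3 + c                                       ≡⟨ cong (3 +_) (length-filter-threeOne-derived sizes) ⟩
      3 + 3 * length (filter (Ω₁ ∈?_) R)          ≡⟨ *-suc 3 _ ⟨
      3 * suc (length (filter (Ω₁ ∈?_) R))        ≡⟨ cong (λ xs → 3 * length xs) (filter-accept (Ω₁ ∈?_) Ω₁∈B) ⟨
      3 * length (filter (Ω₁ ∈?_) (B ∷ R))        ∎
      where
      open ≡-Reasoning
      P = threeOne? {t}
      c = length (filter P (derived R))

    module _ {R : List (Subset (suc t))} (R-parallel : ParallelClass (suc t) R) where

      private
        sizes = proj₁ R-parallel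
        disjoint = proj₁ (proj₂ R-parallel)
        ⋃R≡⊤ = proj₂ (proj₂ R-parallel)

      4*length≡1+t : 4 * length R ≡ suc t
      4*length≡1+t = trans (sym (∣⋃∣≡k*length R sizes disjoint)) (trans (cong ∣_∣ ⋃R≡⊤) (∣⊤∣≡n (suc t)))

      Ω₁-in-one-block : length (filter (Ω₁ ∈?_) R) ≡ 1
      Ω₁-in-one-block = length-filter-∈ R disjoint (subst (Ω₁ ∈_) (sym ⋃R≡⊤) ∈⊤)

      derived-sameLayer-count : length (filter (sameLayer? {t}) (derived {t} R)) ≡ t ∸ 3
      derived-sameLayer-count = begin
        c         ≡⟨ m+n∸n≡m c 3 ⟨
        c + 3 ∸ 3 ≡⟨ cong (_∸ 3) (suc-injective (trans (sym (+-suc c 3)) c+4≡1+t)) ⟩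
        t ∸ 3     ∎
        where
        open ≡-Reasoning
        c = length (filter (sameLayer? {t}) (derived {t} R))
        c+4≡1+t : c + 4 ≡ suc t
        c+4≡1+t = trans (cong (λ w → c + 4 * w) (sym Ω₁-in-one-block))
                        (trans (length-filter-sameLayer-derived sizes) 4*length≡1+t)

      derived-threeOne-count : length (filter (threeOne? {t}) (derived {t} R)) ≡ 3
      derived-threeOne-count = trans (length-filter-threeOne-derived sizes) (cong (3 *_) Ω₁-in-one-block)

    ∈-derived⁺ : {R : List (Subset (suc t))} {B : Subset (suc t)} {Q : Subset (t * 4)} →
                 B ∈ₗ R → Q ∈ₗ blocks' {t} B → Q ∈ₗ derived {t} R
    ∈-derived⁺ B∈R Q∈B = ∈-concatMap⁺ (blocks' {t}) (lose B∈R Q∈B)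

    blockOf∈ : {R : List (Subset (suc t))} {Q : Subset (t * 4)} → All (IsKSubset 4) R →
               Q ∈ₗ derived {t} R → blockOf Q ∈ₗ R
    blockOf∈ {R} sizes Q∈ with find (∈-concatMap⁻ (blocks' {t}) {xs = R} Q∈)
    ... | B , B∈R , Q∈B = subst (_∈ₗ R) (sym (blockOf-blocks' B (All.lookup sizes B∈R) Q∈B)) B∈R

    derived-nonempty : {R : List (Subset (suc t))} → ParallelClass (suc t) R → ∃ λ Q → Q ∈ₗ derived {t} R
    derived-nonempty {R} (sizes , _ , ⋃R≡⊤) with find (x∈⋃⁻ R (subst (Ω₁ ∈_) (sym ⋃R≡⊤) ∈⊤))
    ... | B , B∈R , _ with blocks'-nonempty B (All.lookup sizes B∈R)
    ...   | Q , Q∈B = Q , ∈-derived⁺ B∈R Q∈B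

    derived-injective : {R R′ : List (Subset (suc t))} → ParallelClass (suc t) R → ParallelClass (suc t) R′ →
                        Disjointₗ R R′ → derived {t} R ≢ derived {t} R′
    derived-injective R-parallel R′-parallel R∩R′ R≡R′ with derived-nonempty R-parallel
    ... | Q , Q∈ = R∩R′ (blockOf∈ (proj₁ R-parallel) Q∈ , blockOf∈ (proj₁ R′-parallel) (subst (Q ∈ₗ_) R≡R′ Q∈))

    Ω₁-subsets : List (Subset (suc t))
    Ω₁-subsets = map (_∷ʳ true) (subsets t 3)

    Ω₁-subsets-unique : Unique Ω₁-subsets
    Ω₁-subsets-unique = Unique.map⁺ (∷ʳ-injectiveˡ _ _) (subsets-unique t 3)

    ∈-Ω₁-subsets⁺ : {B : Subset (suc t)} → IsKSubset 4 B → Ω₁ ∈ B → B ∈ₗ Ω₁-subsets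
    ∈-Ω₁-subsets⁺ {B} ∣B∣≡4 Ω₁∈B = subst (_∈ₗ Ω₁-subsets) B≡ (∈-map⁺ (_∷ʳ true) (∈-subsets⁺ ∣init∣≡3))
      where
      ∣init∣≡3 = suc-injective (trans (suc∣init∣≡∣B∣ B (fromℕ∈⇒last Ω₁∈B)) ∣B∣≡4)
      B≡ = trans (cong (init B ∷ʳ_) (sym (fromℕ∈⇒last Ω₁∈B))) (init∷ʳlast B)

    ∈-Ω₁-subsets⁻ : {B : Subset (suc t)} → B ∈ₗ Ω₁-subsets → IsKSubset 4 B × Ω₁ ∈ B
    ∈-Ω₁-subsets⁻ B∈ with ∈-map⁻ (_∷ʳ true) B∈
    ... | A , A∈ , refl = ∣A∷ʳtrue∣≡4 , last⇒fromℕ∈ (last-∷ʳ true A)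
      where
      ∣A∷ʳtrue∣≡4 = begin
        ∣ A ∷ʳ true ∣              ≡⟨ suc∣init∣≡∣B∣ (A ∷ʳ true) (last-∷ʳ true A) ⟨
        suc ∣ init (A ∷ʳ true) ∣   ≡⟨ cong (suc ∘ ∣_∣) (init-∷ʳ true A) ⟩
        suc ∣ A ∣                  ≡⟨ cong suc (∈-subsets⁻ t 3 A∈) ⟩
        4                          ∎
        where open ≡-Reasoning

    module _ {S : List (List (Subset (suc t)))} (S-resolution : BP (suc t) S) where

      private
        classes = proj₁ S-resolution
        exactly-one = proj₂ S-resolution

      Ω₁-blocks : List (Subset (suc t))
      Ω₁-blocks = concatMap (filter (Ω₁ ∈?_)) S

      length-Ω₁-blocks : length Ω₁-blocks ≡ length S
      length-Ω₁-blocks = length-concatMap-singletons (All.map Ω₁-in-one-block classes)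

      Ω₁-blocks-unique : Unique Ω₁-blocks
      Ω₁-blocks-unique = Unique.concat⁺
        (AllP.map⁺ (All.map (length≡1⇒unique ∘ Ω₁-in-one-block) classes))
        (AllPairsP.map⁺ (AllPairs.map filter-disjoint (placed-once⇒disjoint (BP⇒placed-once S-resolution))))
        where
        filter-disjoint : ∀ {R R′} → Disjointₗ R R′ → Disjointₗ (filter (Ω₁ ∈?_) R) (filter (Ω₁ ∈?_) R′)
        filter-disjoint {R} {R′} R∩R′ (B∈ , B∈′) =
          R∩R′ (proj₁ (∈-filter⁻ (Ω₁ ∈?_) {xs = R} B∈) , proj₁ (∈-filter⁻ (Ω₁ ∈?_) {xs = R′} B∈′))

      Ω₁-blocks⊆Ω₁-subsets : ∀ {B} → B ∈ₗ Ω₁-blocks → B ∈ₗ Ω₁-subsets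
      Ω₁-blocks⊆Ω₁-subsets B∈ with find (∈-concatMap⁻ (filter (Ω₁ ∈?_)) {xs = S} B∈)
      ... | R , R∈S , B∈R′ with ∈-filter⁻ (Ω₁ ∈?_) {xs = R} B∈R′
      ...   | B∈R , Ω₁∈B = ∈-Ω₁-subsets⁺ (All.lookup (proj₁ (All.lookup classes R∈S)) B∈R) Ω₁∈B

      Ω₁-subsets⊆Ω₁-blocks : ∀ {B} → B ∈ₗ Ω₁-subsets → B ∈ₗ Ω₁-blocks
      Ω₁-subsets⊆Ω₁-blocks B∈ with ∈-Ω₁-subsets⁻ B∈
      ... | ∣B∣≡4 , Ω₁∈B with exactly-one _ ∣B∣≡4
      ...   | i , B∈i , _ =
        ∈-concatMap⁺ (filter (Ω₁ ∈?_)) (lose (∈-lookup {xs = S} i) (∈-filter⁺ (Ω₁ ∈?_) B∈i Ω₁∈B))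

      number-of-classes : length (map (derived {t}) S) ≡ t C 3
      number-of-classes = begin
        length (map derived S) ≡⟨ length-map derived S ⟩
        length S               ≡⟨ length-Ω₁-blocks ⟨
        length Ω₁-blocks       ≡⟨ ≤-antisym (Unique-⊆⇒length≤ Ω₁-blocks-unique Ω₁-blocks⊆Ω₁-subsets)
                                            (Unique-⊆⇒length≤ Ω₁-subsets-unique Ω₁-subsets⊆Ω₁-blocks) ⟩
        length Ω₁-subsets      ≡⟨ length-map (_∷ʳ true) (subsets t 3) ⟩
        length (subsets t 3)   ≡⟨ length-subsets t 3 ⟩
        t C 3                  ∎
        where open ≡-Reasoning

      sameLayer-in-one-class : {Q : Subset (t * 4)} → IsKSubset 4 Q → SameLayer {t} Q →
                               ExactlyOneClass (map (derived {t}) S) Q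
      sameLayer-in-one-class ∣Q∣≡4 Q-flat with sameLayer-blockOf ∣Q∣≡4 Q-flat
      ... | ∣blockOf∣≡4 , Q∈ = ExactlyOneClass-map derived
        (All.map (λ R-parallel → blockOf∈ (proj₁ R-parallel)) classes)
        (λ blockOf∈R → ∈-derived⁺ blockOf∈R Q∈)
        (exactly-one _ ∣blockOf∣≡4)

      derived-unique : Unique (map (derived {t}) S)
      derived-unique = AllPairsP.map⁺ (distinct classes (placed-once⇒disjoint (BP⇒placed-once S-resolution)))
        where
        distinct : ∀ {S} → All (ParallelClass (suc t)) S → AllPairs Disjointₗ S →
                   AllPairs (λ R R′ → derived {t} R ≢ derived {t} R′) S
        distinct []                       []                 = []
        distinct (R-parallel ∷ parallels) (R∩S ∷ disjoint) =
          All.tabulate (λ R′∈ → derived-injective R-parallel (All.lookup parallels R′∈) (All.lookup R∩S R′∈))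
          ∷ distinct parallels disjoint

open import Data.List.Membership.Propositional using (_∈_)

lemma6 : (t : ℕ) → t % 4 ≡ 3 →
         (S : List (List (Subset (suc t)))) → BP (suc t) S →
         ((R : List (Subset (suc t))) → R ∈ S → ParallelClass (t * 4) (derived {t} R))
         × ((B : Subset (t * 4)) → IsKSubset 4 B → SameLayer {t} B →
              ExactlyOneClass (map (derived {t}) S) B)
         × (length (map (derived {t}) S) ≡ t C 3)
         × Unique (map (derived {t}) S)
         × ((R : List (Subset (suc t))) → R ∈ S →
              (length (filter (sameLayer? {t}) (derived {t} R)) ≡ t ∸ 3)
              × (length (filter (threeOne? {t}) (derived {t} R)) ≡ 3))
-- t ≡ 3 (mod 4) is only needed for a BP(t + 1, 4) to exist; the construction works for every t.
lemma6 t _ S S-resolution@(classes , _) =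
    (λ R R∈S → derived-parallel (All.lookup classes R∈S))
  , (λ Q ∣Q∣≡4 Q-flat → sameLayer-in-one-class S-resolution ∣Q∣≡4 Q-flat)
  , number-of-classes S-resolution
  , derived-unique S-resolution
  , λ R R∈S → derived-sameLayer-count (All.lookup classes R∈S) , derived-threeOne-count (All.lookup classes R∈S)
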